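{- There is an absolute constant $C>0$ such that for all positive integers $n$ and $k$, $$\mathrm{bp}_{1.5}\bigl(K_{n^{2k-1}}\bigr)\le C\,k\,n^{k},$$ where $K_{n^{2k-1}}$ is the complete graph on $n^{2k-1}$ vertices.
   Context: For disjoint vertex sets $U,W$, the biclique $\mathcal{B}(U,W)$ is the complete bipartite graph with edge set $\{\{u,w\}: u\in U, w\in W\}$; $U$ is its first class and $W$ its second class. An ordered biclique partition of a graph $G=(V,E)$ is a collection of bicliques $\{\mathcal{B}(U_i,W_i)\}_i$ with $U_i,W_i\subseteq V$ disjoint, each of whose edges is an edge of $G$, such that (i) every edge of $G$ lies in at least one and at most two bicliques of the collection, and (ii) if an edge $e=\{u,v\}$ lies in two bicliques $\mathcal{B}(U_k,W_k)$ and $\mathcal{B}(U_\ell,W_\ell)$, then for each endpoint $w\in\{u,v\}$ we have $w\in U_k\cap W_\ell$ or $w\in U_\ell\cap W_k$. $\mathrm{bp}_{1.5}(G)$ denotes the minimum size of an ordered biclique partition of $G$. -}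

module Defs where

open import Data.Nat using (ℕ; _≤_)
open import Data.Fin using (Fin)
open import Data.Fin.Subset using (Subset; _∈_; _∉_)
open import Data.Product using (_×_; ∃-syntax)
open import Data.Sum using (_⊎_)
open import Relation.Nullary using (¬_)
open import Relation.Binary.PropositionalEquality using (_≡_; _≢_; refl) renaming (sym to ≡-sym)

record Graph (N : ℕ) : Set₁ where
  field
    Adj     : Fin N → Fin N → Set
    sym     : ∀ {u v} → Adj u v → Adj v u
    irrefl  : ∀ {u} → ¬ Adj u u

complete : (N : ℕ) → Graph N
complete N = record
  { Adj = λ u v → u ≢ v
  ; sym = λ p q → p (≡-sym q)
  ; irrefl = λ p → p refl
  }

record Biclique (N : ℕ) : Set where
  constructor biclique
  field
    first  : Subset N
    second : Subset N
open Biclique public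

EdgeIn : ∀ {N} → Biclique N → Fin N → Fin N → Set
EdgeIn B u v = (u ∈ first B × v ∈ second B) ⊎ (v ∈ first B × u ∈ second B)

record IsOrderedBicliquePartition {N : ℕ} (G : Graph N) (m : ℕ)
                                  (B : Fin m → Biclique N) : Set where
  open Graph G
  field
    disjoint    : ∀ i v → v ∈ first (B i) → v ∉ second (B i)
    edges-in-G  : ∀ i u v → EdgeIn (B i) u v → Adj u v
    covered     : ∀ u v → Adj u v → ∃[ i ] EdgeIn (B i) u v
    at-most-two : ∀ u v i j l → EdgeIn (B i) u v → EdgeIn (B j) u v → EdgeIn (B l) u v →
                  i ≡ j ⊎ i ≡ l ⊎ j ≡ l
    ordered     : ∀ u v i j → i ≢ j → EdgeIn (B i) u v → EdgeIn (B j) u v →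
                  ∀ w → w ≡ u ⊎ w ≡ v →
                  (w ∈ first (B i) × w ∈ second (B j)) ⊎ (w ∈ first (B j) × w ∈ second (B i))

-- bp_{1.5}(G) ≤ b  :⇔  G has an ordered biclique partition of size at most b.
bp1·5≤ : ∀ {N} → Graph N → ℕ → Set
bp1·5≤ G b = ∃[ m ] (m ≤ b × ∃[ B ] IsOrderedBicliquePartition G m B)

-- A vertex of K_{n^(2k-1)} is a point (α , β) ∈ [n]^k × [n]^(k-1), coordinates indexed from 0.
-- Give an ordered pair u → v of distinct points the label
--   A i  if α u, α v first differ at i and β u ≤ β v lexicographically from position i on;
--   B j  if β u, β v first differ at j, with β v j < β u j, and α u, α v agree after j.
-- Each ordered pair has at most one label (for A i against B j: B j forces i ≤ j and makes
-- β u > β v from position i on), every pair of distinct points is labelled in some direction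
-- (by an A-label if α u ≢ α v, by a B-label otherwise), and whether u → v has a given label
-- depends on u only through a key in [n]^k. So for every label and key the tails with that
-- key and the heads of their arcs span a biclique, and these (2k-1)·n^k bicliques contain
-- every ordered pair at most once, which is precisely an ordered biclique partition.
module Submission where

open import Defs
open import Data.Bool using (true)
open import Data.Empty using (⊥-elim)
open import Data.Fin as Fin using (Fin; zero; suc)
open import Data.Fin.Properties using (_≟_; <-cmp; <-irrefl; <-asym; +↔⊎; *↔×)
open import Data.Fin.Subset using (Subset; _∈_; _∉_)
open import Data.Nat using (ℕ; zero; suc; _+_; _*_; _^_; _∸_; _<_; _≤_; s≤s; z≤n)
import Data.Nat.Properties as ℕ
open import Data.Product using (_×_; _,_; ∃-syntax; proj₁; proj₂)
open import Data.Product.Algebra using (×-cong)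
open import Data.Sum using (_⊎_; inj₁; inj₂)
open import Data.Vec using (Vec; []; _∷_; tabulate)
open import Data.Vec.Properties using (lookup⇒[]=; []=⇒lookup; lookup∘tabulate; ∷-injectiveˡ; ∷-injectiveʳ)
  renaming (≡-dec to ≡-decᵛ)
open import Data.Vec.Recursive using (Fin[m^n]↔Fin[m]^n)
open import Data.Vec.Recursive.Properties using (↔Vec)
open import Data.Vec.Relation.Binary.Lex.Core using (this; next)
open import Data.Vec.Relation.Binary.Lex.Strict using (Lex-≤; ≤-total; ≤-dec)
open import Function.Base using (_∘_)
open import Function.Bundles using (_↔_; Inverse; Injection)
open import Function.Properties.Inverse using (↔-trans; ↔⇒↣)
open import Relation.Binary.Definitions using (DecidableEquality; tri<; tri≈; tri>)
open import Relation.Binary.PropositionalEquality using (_≡_; _≢_; refl; sym; trans; cong; subst)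
open import Relation.Nullary using (¬_; Dec; yes; no; does; proof)
open import Relation.Nullary.Reflects using (Reflects; invert)
open import Relation.Nullary.Decidable using (dec-true; _×-dec_; ¬?)

module _ {N m : ℕ} (B : Fin m → Biclique N) where

  Arc : Fin m → Fin N → Fin N → Set
  Arc i u v = u ∈ first (B i) × v ∈ second (B i)

  unique-arcs⇒ordered-partition :
    (∀ i v → v ∈ first (B i) → v ∉ second (B i)) →
    (∀ {i j u v} → Arc i u v → Arc j u v → i ≡ j) →
    (∀ u v → u ≢ v → ∃[ i ] EdgeIn (B i) u v) →
    IsOrderedBicliquePartition (complete N) m B
  unique-arcs⇒ordered-partition disjoint unique covered = record
    { disjoint    = disjoint
    ; edges-in-G  = edges-in-G
    ; covered     = covered
    ; at-most-two = at-most-two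
    ; ordered     = ordered
    }
    where
      edges-in-G : ∀ i u v → EdgeIn (B i) u v → u ≢ v
      edges-in-G i u v (inj₁ (u∈U , v∈W)) refl = disjoint i u u∈U v∈W
      edges-in-G i u v (inj₂ (v∈U , u∈W)) refl = disjoint i u v∈U u∈W

      at-most-two : ∀ u v i j l → EdgeIn (B i) u v → EdgeIn (B j) u v → EdgeIn (B l) u v →
                    i ≡ j ⊎ i ≡ l ⊎ j ≡ l
      at-most-two u v i j l (inj₁ eᵢ) (inj₁ eⱼ) _         = inj₁ (unique eᵢ eⱼ)
      at-most-two u v i j l (inj₂ eᵢ) (inj₂ eⱼ) _         = inj₁ (unique eᵢ eⱼ)
      at-most-two u v i j l (inj₁ eᵢ) (inj₂ _)  (inj₁ eₗ) = inj₂ (inj₁ (unique eᵢ eₗ))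
      at-most-two u v i j l (inj₂ eᵢ) (inj₁ _)  (inj₂ eₗ) = inj₂ (inj₁ (unique eᵢ eₗ))
      at-most-two u v i j l (inj₁ _)  (inj₂ eⱼ) (inj₂ eₗ) = inj₂ (inj₂ (unique eⱼ eₗ))
      at-most-two u v i j l (inj₂ _)  (inj₁ eⱼ) (inj₁ eₗ) = inj₂ (inj₂ (unique eⱼ eₗ))

      ordered : ∀ u v i j → i ≢ j → EdgeIn (B i) u v → EdgeIn (B j) u v →
                ∀ w → w ≡ u ⊎ w ≡ v →
                (w ∈ first (B i) × w ∈ second (B j)) ⊎ (w ∈ first (B j) × w ∈ second (B i))
      ordered u v i j i≢j (inj₁ eᵢ) (inj₁ eⱼ) _ _ = ⊥-elim (i≢j (unique eᵢ eⱼ))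
      ordered u v i j i≢j (inj₂ eᵢ) (inj₂ eⱼ) _ _ = ⊥-elim (i≢j (unique eᵢ eⱼ))
      ordered u v i j _ (inj₁ (u∈Uᵢ , v∈Wᵢ)) (inj₂ (v∈Uⱼ , u∈Wⱼ)) w (inj₁ refl) = inj₁ (u∈Uᵢ , u∈Wⱼ)
      ordered u v i j _ (inj₁ (u∈Uᵢ , v∈Wᵢ)) (inj₂ (v∈Uⱼ , u∈Wⱼ)) w (inj₂ refl) = inj₂ (v∈Uⱼ , v∈Wᵢ)
      ordered u v i j _ (inj₂ (v∈Uᵢ , u∈Wᵢ)) (inj₁ (u∈Uⱼ , v∈Wⱼ)) w (inj₁ refl) = inj₂ (u∈Uⱼ , u∈Wᵢ)
      ordered u v i j _ (inj₂ (v∈Uᵢ , u∈Wᵢ)) (inj₁ (u∈Uⱼ , v∈Wⱼ)) w (inj₂ refl) = inj₁ (v∈Uᵢ , v∈Wⱼ)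

bp1·5≤-mono : ∀ {N} (G : Graph N) {b b′} → b ≤ b′ → bp1·5≤ G b → bp1·5≤ G b′
bp1·5≤-mono G b≤b′ (m , m≤b , B , isPartition) = m , ℕ.≤-trans m≤b b≤b′ , B , isPartition

module _ {N : ℕ} {P : Fin N → Set} (P? : ∀ x → Dec (P x)) where

  subset : Subset N
  subset = tabulate (does ∘ P?)

  ∈-subset⁺ : ∀ {x} → P x → x ∈ subset
  ∈-subset⁺ {x} p = lookup⇒[]= x subset (trans (lookup∘tabulate (does ∘ P?) x) (dec-true (P? x) p))

  ∈-subset⁻ : ∀ {x} → x ∈ subset → P x
  ∈-subset⁻ {x} x∈ = invert (subst (Reflects (P x)) does≡true (proof (P? x)))
    where
      does≡true : does (P? x) ≡ true
      does≡true = trans (sym (lookup∘tabulate (does ∘ P?) x)) ([]=⇒lookup x∈)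

record OrientedBicliqueCover (V I : Set) : Set₁ where
  field
    First Second : I → V → Set
    first?   : ∀ ι x → Dec (First ι x)
    second?  : ∀ ι x → Dec (Second ι x)
    disjoint : ∀ {ι x} → First ι x → ¬ Second ι x

  Joins : I → V → V → Set
  Joins ι u v = First ι u × Second ι v

  field
    unique : ∀ {ι κ u v} → Joins ι u v → Joins κ u v → ι ≡ κ
    cover  : ∀ {u v} → u ≢ v → ∃[ ι ] (Joins ι u v ⊎ Joins ι v u)

pullback : ∀ {V I V′ I′} → V′ ↔ V → I′ ↔ I → OrientedBicliqueCover V I → OrientedBicliqueCover V′ I′
pullback e c C = record
  { First    = λ ι x → First (to c ι) (to e x)
  ; Second   = λ ι x → Second (to c ι) (to e x)
  ; first?   = λ ι x → first? (to c ι) (to e x)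
  ; second?  = λ ι x → second? (to c ι) (to e x)
  ; disjoint = disjoint
  ; unique   = λ arc arc′ → Injection.injective (↔⇒↣ c) (unique arc arc′)
  ; cover    = cover′
  }
  where
    open OrientedBicliqueCover C
    open Inverse using (to; from; strictlyInverseˡ)

    cover′ : ∀ {u v} → u ≢ v → ∃[ ι ] (Joins (to c ι) (to e u) (to e v) ⊎ Joins (to c ι) (to e v) (to e u))
    cover′ {u} {v} u≢v with cover (u≢v ∘ Injection.injective (↔⇒↣ e))
    ... | ι , joins = from c ι , subst (λ κ → Joins κ (to e u) (to e v) ⊎ Joins κ (to e v) (to e u))
                                       (sym (strictlyInverseˡ c ι)) joins

cover⇒bp1·5≤ : ∀ {N M} → OrientedBicliqueCover (Fin N) (Fin M) → bp1·5≤ (complete N) M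
cover⇒bp1·5≤ {N} {M} C = M , ℕ.≤-refl , B , unique-arcs⇒ordered-partition B disjoint′ unique′ covered
  where
    open OrientedBicliqueCover C

    B : Fin M → Biclique N
    B i = biclique (subset (first? i)) (subset (second? i))

    disjoint′ : ∀ i v → v ∈ first (B i) → v ∉ second (B i)
    disjoint′ i v v∈U v∈W = disjoint (∈-subset⁻ (first? i) v∈U) (∈-subset⁻ (second? i) v∈W)

    unique′ : ∀ {i j u v} → Arc B i u v → Arc B j u v → i ≡ j
    unique′ {i} {j} (u∈Uᵢ , v∈Wᵢ) (u∈Uⱼ , v∈Wⱼ) =
      unique (∈-subset⁻ (first? i) u∈Uᵢ , ∈-subset⁻ (second? i) v∈Wᵢ)
             (∈-subset⁻ (first? j) u∈Uⱼ , ∈-subset⁻ (second? j) v∈Wⱼ)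

    covered : ∀ u v → u ≢ v → ∃[ i ] EdgeIn (B i) u v
    covered u v u≢v with cover u≢v
    ... | i , inj₁ (u∈U , v∈W) = i , inj₁ (∈-subset⁺ (first? i) u∈U , ∈-subset⁺ (second? i) v∈W)
    ... | i , inj₂ (v∈U , u∈W) = i , inj₂ (∈-subset⁺ (first? i) v∈U , ∈-subset⁺ (second? i) u∈W)

module _ {V L K : Set} (key : L → V → K) (Member : L → K → V → Set) where

  LabelledArc : L → V → V → Set
  LabelledArc ℓ u v = Member ℓ (key ℓ u) v

  Tails Heads : L × K → V → Set
  Tails (ℓ , w) u = key ℓ u ≡ w
  Heads (ℓ , w) v = Member ℓ w v

  labelling⇒cover : DecidableEquality K → (∀ ℓ w v → Dec (Member ℓ w v)) →
                    (∀ ℓ u → ¬ LabelledArc ℓ u u) →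
                    (∀ ℓ ℓ′ u v → LabelledArc ℓ u v → LabelledArc ℓ′ u v → ℓ ≡ ℓ′) →
                    (∀ u v → u ≢ v → ∃[ ℓ ] (LabelledArc ℓ u v ⊎ LabelledArc ℓ v u)) →
                    OrientedBicliqueCover V (L × K)
  labelling⇒cover _≟ᴷ_ member? irrefl label-unique total = record
    { First    = Tails
    ; Second   = Heads
    ; first?   = λ (ℓ , w) u → key ℓ u ≟ᴷ w
    ; second?  = λ (ℓ , w) v → member? ℓ w v
    ; disjoint = λ { {ℓ , _} {u} refl → irrefl ℓ u }
    ; unique   = unique
    ; cover    = cover
    }
    where
      unique : ∀ {ι κ u v} → Tails ι u × Heads ι v → Tails κ u × Heads κ v → ι ≡ κ
      unique {ℓ , _} {ℓ′ , _} {u} {v} (refl , arc) (refl , arc′) =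
        cong (λ ℓ → ℓ , key ℓ u) (label-unique ℓ ℓ′ u v arc arc′)

      cover : ∀ {u v} → u ≢ v → ∃[ ι ] ((Tails ι u × Heads ι v) ⊎ (Tails ι v × Heads ι u))
      cover {u} {v} u≢v with total u v u≢v
      ... | ℓ , inj₁ arc = (ℓ , key ℓ u) , inj₁ (refl , arc)
      ... | ℓ , inj₂ arc = (ℓ , key ℓ v) , inj₂ (refl , arc)

module Construction (n : ℕ) where

  _≟ᵛ_ : ∀ {r} → DecidableEquality (Vec (Fin n) r)
  _≟ᵛ_ = ≡-decᵛ _≟_

  _≤ₗ_ : ∀ {r} → Vec (Fin n) r → Vec (Fin n) r → Set
  _≤ₗ_ = Lex-≤ _≡_ Fin._<_

  Point : ℕ → Set
  Point r = Vec (Fin n) (suc r) × Vec (Fin n) r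

  A-key : ∀ {r} → Fin (suc r) → Point r → Vec (Fin n) (suc r)
  A-key {zero}  _       (α , [])        = α
  A-key {suc r} zero    (a ∷ α , β)     = a ∷ β
  A-key {suc r} (suc f) (a ∷ α , b ∷ β) = a ∷ A-key f (α , β)

  A-member : ∀ {r} → Fin (suc r) → Vec (Fin n) (suc r) → Point r → Set
  A-member {zero}  _       α       (α′ , [])           = α ≢ α′
  A-member {suc r} zero    (a ∷ β) (a′ ∷ α′ , β′)      = a ≢ a′ × β ≤ₗ β′
  A-member {suc r} (suc f) (a ∷ w) (a′ ∷ α′ , b′ ∷ β′) = a ≡ a′ × A-member f w (α′ , β′)

  B-key : ∀ {r} → Fin r → Point r → Vec (Fin n) (suc r)
  B-key zero    (a ∷ α , b ∷ β) = b ∷ α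
  B-key (suc g) (a ∷ α , b ∷ β) = b ∷ B-key g (α , β)

  B-member : ∀ {r} → Fin r → Vec (Fin n) (suc r) → Point r → Set
  B-member zero    (b ∷ α) (a′ ∷ α′ , b′ ∷ β′) = b′ Fin.< b × α ≡ α′
  B-member (suc g) (b ∷ w) (a′ ∷ α′ , b′ ∷ β′) = b ≡ b′ × B-member g w (α′ , β′)

  A-arc : ∀ {r} → Fin (suc r) → Point r → Point r → Set
  A-arc f u = A-member f (A-key f u)

  B-arc : ∀ {r} → Fin r → Point r → Point r → Set
  B-arc g u = B-member g (B-key g u)

  A-arc-irrefl : ∀ {r} f (u : Point r) → ¬ A-arc f u u
  A-arc-irrefl {zero}  _       (α , [])        α≢α        = α≢α refl
  A-arc-irrefl {suc r} zero    (a ∷ α , β)     (a≢a , _)  = a≢a refl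
  A-arc-irrefl {suc r} (suc f) (a ∷ α , b ∷ β) (_ , arc)  = A-arc-irrefl f (α , β) arc

  B-arc-irrefl : ∀ {r} g (u : Point r) → ¬ B-arc g u u
  B-arc-irrefl zero    (a ∷ α , b ∷ β) (b<b , _) = <-irrefl refl b<b
  B-arc-irrefl (suc g) (a ∷ α , b ∷ β) (_ , arc) = B-arc-irrefl g (α , β) arc

  A-arc-unique : ∀ {r} f f′ (u v : Point r) → A-arc f u v → A-arc f′ u v → f ≡ f′
  A-arc-unique         zero    zero     _ _ _ _ = refl
  A-arc-unique {suc r} zero    (suc f′) (a ∷ α , b ∷ β) (a′ ∷ α′ , b′ ∷ β′) (a≢a′ , _) (a≡a′ , _) =
    ⊥-elim (a≢a′ a≡a′)
  A-arc-unique {suc r} (suc f) zero     (a ∷ α , b ∷ β) (a′ ∷ α′ , b′ ∷ β′) (a≡a′ , _) (a≢a′ , _) =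
    ⊥-elim (a≢a′ a≡a′)
  A-arc-unique {suc r} (suc f) (suc f′) (a ∷ α , b ∷ β) (a′ ∷ α′ , b′ ∷ β′) (_ , arc) (_ , arc′) =
    cong suc (A-arc-unique f f′ (α , β) (α′ , β′) arc arc′)

  B-arc-unique : ∀ {r} g g′ (u v : Point r) → B-arc g u v → B-arc g′ u v → g ≡ g′
  B-arc-unique zero    zero     _ _ _ _ = refl
  B-arc-unique zero    (suc g′) (a ∷ α , b ∷ β) (a′ ∷ α′ , b′ ∷ β′) (b′<b , _) (b≡b′ , _) =
    ⊥-elim (<-irrefl (sym b≡b′) b′<b)
  B-arc-unique (suc g) zero     (a ∷ α , b ∷ β) (a′ ∷ α′ , b′ ∷ β′) (b≡b′ , _) (b′<b , _) =
    ⊥-elim (<-irrefl (sym b≡b′) b′<b)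
  B-arc-unique (suc g) (suc g′) (a ∷ α , b ∷ β) (a′ ∷ α′ , b′ ∷ β′) (_ , arc) (_ , arc′) =
    cong suc (B-arc-unique g g′ (α , β) (α′ , β′) arc arc′)

  A-arc⇒α≢ : ∀ {r} f (u v : Point r) → A-arc f u v → proj₁ u ≢ proj₁ v
  A-arc⇒α≢ {zero}  _       (α , [])        (α′ , [])           α≢α′       = α≢α′
  A-arc⇒α≢ {suc r} zero    (a ∷ α , β)     (a′ ∷ α′ , β′)      (a≢a′ , _) = a≢a′ ∘ ∷-injectiveˡ
  A-arc⇒α≢ {suc r} (suc f) (a ∷ α , b ∷ β) (a′ ∷ α′ , b′ ∷ β′) (_ , arc) =
    A-arc⇒α≢ f (α , β) (α′ , β′) arc ∘ ∷-injectiveʳ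

  B-arc⇒β≰ : ∀ {r} g (u v : Point r) → B-arc g u v → ¬ proj₂ u ≤ₗ proj₂ v
  B-arc⇒β≰ zero    (a ∷ α , b ∷ β) (a′ ∷ α′ , b′ ∷ β′) (b′<b , _) (this b<b′ _) = <-asym b<b′ b′<b
  B-arc⇒β≰ zero    (a ∷ α , b ∷ β) (a′ ∷ α′ , b′ ∷ β′) (b′<b , _) (next b≡b′ _) = <-irrefl (sym b≡b′) b′<b
  B-arc⇒β≰ (suc g) (a ∷ α , b ∷ β) (a′ ∷ α′ , b′ ∷ β′) (b≡b′ , _) (this b<b′ _) = <-irrefl b≡b′ b<b′
  B-arc⇒β≰ (suc g) (a ∷ α , b ∷ β) (a′ ∷ α′ , b′ ∷ β′) (_ , arc) (next _ β≤β′) =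
    B-arc⇒β≰ g (α , β) (α′ , β′) arc β≤β′

  A-arc⇒¬B-arc : ∀ {r} f g (u v : Point r) → A-arc f u v → ¬ B-arc g u v
  A-arc⇒¬B-arc {suc r} zero    g       (a ∷ α , β) (a′ ∷ α′ , β′) (_ , β≤β′) arcᴮ =
    B-arc⇒β≰ g (a ∷ α , β) (a′ ∷ α′ , β′) arcᴮ β≤β′
  A-arc⇒¬B-arc {suc r} (suc f) zero    (a ∷ α , b ∷ β) (a′ ∷ α′ , b′ ∷ β′) (_ , arcᴬ) (_ , α≡α′) =
    A-arc⇒α≢ f (α , β) (α′ , β′) arcᴬ α≡α′
  A-arc⇒¬B-arc {suc r} (suc f) (suc g) (a ∷ α , b ∷ β) (a′ ∷ α′ , b′ ∷ β′) (_ , arcᴬ) (_ , arcᴮ) =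
    A-arc⇒¬B-arc f g (α , β) (α′ , β′) arcᴬ arcᴮ

  A-arc-total : ∀ {r} (u v : Point r) → proj₁ u ≢ proj₁ v → ∃[ f ] (A-arc f u v ⊎ A-arc f v u)
  A-arc-total {zero} (α , []) (α′ , []) α≢α′ = zero , inj₁ α≢α′
  A-arc-total {suc r} (a ∷ α , b ∷ β) (a′ ∷ α′ , b′ ∷ β′) α≢α′ with a ≟ a′
  ... | no a≢a′ with ≤-total sym <-cmp (b ∷ β) (b′ ∷ β′)
  ...   | inj₁ β≤β′ = zero , inj₁ (a≢a′ , β≤β′)
  ...   | inj₂ β′≤β = zero , inj₂ (a≢a′ ∘ sym , β′≤β)
  A-arc-total {suc r} (a ∷ α , b ∷ β) (.a ∷ α′ , b′ ∷ β′) α≢α′ | yes refl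
    with A-arc-total (α , β) (α′ , β′) (α≢α′ ∘ cong (a ∷_))
  ... | f , inj₁ arc = suc f , inj₁ (refl , arc)
  ... | f , inj₂ arc = suc f , inj₂ (refl , arc)

  B-arc-total : ∀ {r} (u v : Point r) → proj₁ u ≡ proj₁ v → u ≢ v → ∃[ g ] (B-arc g u v ⊎ B-arc g v u)
  B-arc-total {zero} (α , []) (.α , []) refl u≢v = ⊥-elim (u≢v refl)
  B-arc-total {suc r} (a ∷ α , b ∷ β) (.a ∷ .α , b′ ∷ β′) refl u≢v with <-cmp b b′
  ... | tri< b<b′ _ _ = zero , inj₂ (b<b′ , refl)
  ... | tri> _ _ b′<b = zero , inj₁ (b′<b , refl)
  ... | tri≈ _ refl _ with B-arc-total (α , β) (α , β′) refl (u≢v ∘ cong (λ (α , β) → a ∷ α , b ∷ β))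
  ...   | g , inj₁ arc = suc g , inj₁ (refl , arc)
  ...   | g , inj₂ arc = suc g , inj₂ (refl , arc)

  A-member? : ∀ {r} f w (v : Point r) → Dec (A-member f w v)
  A-member? {zero}  _       α       (α′ , [])           = ¬? (α ≟ᵛ α′)
  A-member? {suc r} zero    (a ∷ β) (a′ ∷ α′ , β′)      = ¬? (a ≟ a′) ×-dec ≤-dec _≟_ Fin._<?_ β β′
  A-member? {suc r} (suc f) (a ∷ w) (a′ ∷ α′ , b′ ∷ β′) = (a ≟ a′) ×-dec A-member? f w (α′ , β′)

  B-member? : ∀ {r} g w (v : Point r) → Dec (B-member g w v)
  B-member? zero    (b ∷ α) (a′ ∷ α′ , b′ ∷ β′) = (b′ Fin.<? b) ×-dec (α ≟ᵛ α′)
  B-member? (suc g) (b ∷ w) (a′ ∷ α′ , b′ ∷ β′) = (b ≟ b′) ×-dec B-member? g w (α′ , β′)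

  Label : ℕ → Set
  Label r = Fin (suc r) ⊎ Fin r

  key : ∀ {r} → Label r → Point r → Vec (Fin n) (suc r)
  key (inj₁ f) = A-key f
  key (inj₂ g) = B-key g

  Member : ∀ {r} → Label r → Vec (Fin n) (suc r) → Point r → Set
  Member (inj₁ f) = A-member f
  Member (inj₂ g) = B-member g

  member? : ∀ {r} ℓ w (v : Point r) → Dec (Member ℓ w v)
  member? (inj₁ f) = A-member? f
  member? (inj₂ g) = B-member? g

  cover : ∀ r → OrientedBicliqueCover (Point r) (Label r × Vec (Fin n) (suc r))
  cover r = labelling⇒cover key Member _≟ᵛ_ member? irrefl label-unique total
    where
      irrefl : ∀ ℓ u → ¬ LabelledArc key Member ℓ u u
      irrefl (inj₁ f) = A-arc-irrefl f
      irrefl (inj₂ g) = B-arc-irrefl g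

      label-unique : ∀ ℓ ℓ′ u v → LabelledArc key Member ℓ u v → LabelledArc key Member ℓ′ u v → ℓ ≡ ℓ′
      label-unique (inj₁ f) (inj₁ f′) u v arc arc′ = cong inj₁ (A-arc-unique f f′ u v arc arc′)
      label-unique (inj₂ g) (inj₂ g′) u v arc arc′ = cong inj₂ (B-arc-unique g g′ u v arc arc′)
      label-unique (inj₁ f) (inj₂ g)  u v arc arc′ = ⊥-elim (A-arc⇒¬B-arc f g u v arc arc′)
      label-unique (inj₂ g) (inj₁ f)  u v arc arc′ = ⊥-elim (A-arc⇒¬B-arc f g u v arc′ arc)

      total : ∀ u v → u ≢ v → ∃[ ℓ ] (LabelledArc key Member ℓ u v ⊎ LabelledArc key Member ℓ v u)
      total u v u≢v with proj₁ u ≟ᵛ proj₁ v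
      ... | no α≢α′ with A-arc-total u v α≢α′
      ...   | f , arc = inj₁ f , arc
      total u v u≢v | yes α≡α′ with B-arc-total u v α≡α′ u≢v
      ...   | g , arc = inj₂ g , arc

Fin^↔Vec : ∀ n e → Fin (n ^ e) ↔ Vec (Fin n) e
Fin^↔Vec n e = ↔-trans (Fin[m^n]↔Fin[m]^n n e) (↔Vec e)

Point-count : ∀ n r → Fin (n ^ (suc r + r)) ↔ Construction.Point n r
Point-count n r = subst (λ N → Fin N ↔ Construction.Point n r) (sym (ℕ.^-distribˡ-+-* n (suc r) r))
                        (↔-trans *↔× (×-cong (Fin^↔Vec n (suc r)) (Fin^↔Vec n r)))

Label-count : ∀ n r → Fin ((suc r + r) * n ^ suc r) ↔ (Construction.Label n r × Vec (Fin n) (suc r))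
Label-count n r = ↔-trans *↔× (×-cong +↔⊎ (Fin^↔Vec n (suc r)))

bp1·5≤-complete : ∀ n r → bp1·5≤ (complete (n ^ (suc r + r))) ((suc r + r) * n ^ suc r)
bp1·5≤-complete n r = cover⇒bp1·5≤ (pullback (Point-count n r) (Label-count n r) (Construction.cover n r))

theorem1 : ∃[ C ] (0 < C × (∀ (n k : ℕ) → 1 ≤ n → 1 ≤ k →
             bp1·5≤ (complete (n ^ (2 * k ∸ 1))) (C * k * n ^ k)))
theorem1 = 2 , s≤s z≤n , bound
  where
    bound : ∀ n k → 1 ≤ n → 1 ≤ k → bp1·5≤ (complete (n ^ (2 * k ∸ 1))) (2 * k * n ^ k)
    bound n (suc r) _ _ =
      subst (λ e → bp1·5≤ (complete (n ^ e)) (2 * suc r * n ^ suc r)) exponent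
        (bp1·5≤-mono (complete _) (ℕ.*-monoˡ-≤ (n ^ suc r) labels≤) (bp1·5≤-complete n r))
      where
        exponent : suc r + r ≡ 2 * suc r ∸ 1
        exponent = sym (trans (ℕ.+-suc r (r + 0)) (cong (λ m → suc (r + m)) (ℕ.+-identityʳ r)))

        labels≤ : suc r + r ≤ 2 * suc r
        labels≤ = ℕ.+-monoʳ-≤ (suc r) (ℕ.≤-trans (ℕ.n≤1+n r) (ℕ.m≤m+n (suc r) 0))
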